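{- Let $X$ be a connected trivalent vertex-transitive graph of order $2n$ admitting an $\mathrm{Aut}(X)$-invariant partition of $E(X)$ into a $1$-factor and a $2$-factor $F$, where $F$ consists of two $n$-cycles $C_1$ and $C_2$. Let $U=V(C_1)$ and let $H$ be the group of permutations of $U$ obtained by restricting to $U$ the elements of the setwise stabilizer $\mathrm{Aut}(X)_{\{U\}}$. If $H$ contains an $n$-cycle, then $X$ is isomorphic to a generalized Petersen graph $\mathrm{GP}(n,k)$ for some $k$.
   Context: A partition of $E(X)$ into factors is $\mathrm{Aut}(X)$-invariant if every automorphism of $X$ maps each factor onto itself. The generalized Petersen graph $\mathrm{GP}(n,k)$ has vertices $u_0,\dots,u_{n-1},v_0,\dots,v_{n-1}$ and edges $[u_i,u_{i+1}]$, $[u_i,v_i]$, $[v_i,v_{i+k}]$ for all $i$, subscripts modulo $n$. -}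

module Defs where

open import Level using (0ℓ)
open import Data.Nat using (ℕ; zero; suc; _+_; _%_; NonZero)
open import Data.Fin using (Fin; toℕ; splitAt)
open import Data.Sum using (_⊎_; inj₁; inj₂)
open import Data.Product using (Σ; ∃; ∃-syntax; _×_; _,_)
open import Data.Empty using (⊥)
open import Relation.Nullary using (¬_)
open import Relation.Binary.PropositionalEquality using (_≡_; _≢_)
open import Relation.Binary.Construct.Closure.ReflexiveTransitive using (Star)
open import Function.Bundles using (_↔_; _⇔_; Inverse)

record Graph (N : ℕ) : Set₁ where
  field
    Adj    : Fin N → Fin N → Set
    sym    : ∀ {x y} → Adj x y → Adj y x
    irrefl : ∀ {x} → ¬ Adj x x
open Graph public

ExactlyOne : {N : ℕ} → (Fin N → Fin N → Set) → Set
ExactlyOne R = ∀ x → ∃[ a ] (R x a × (∀ y → R x y → y ≡ a))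

ExactlyTwo : {N : ℕ} → (Fin N → Fin N → Set) → Set
ExactlyTwo R = ∀ x → ∃[ a ] ∃[ b ] (a ≢ b × R x a × R x b ×
                 (∀ y → R x y → y ≡ a ⊎ y ≡ b))

ExactlyThree : {N : ℕ} → (Fin N → Fin N → Set) → Set
ExactlyThree R = ∀ x → ∃[ a ] ∃[ b ] ∃[ c ] (a ≢ b × a ≢ c × b ≢ c ×
                 R x a × R x b × R x c ×
                 (∀ y → R x y → y ≡ a ⊎ y ≡ b ⊎ y ≡ c))

Trivalent : {N : ℕ} → Graph N → Set
Trivalent X = ExactlyThree (Adj X)

Connected : {N : ℕ} → Graph N → Set
Connected X = ∀ x y → Star (Adj X) x y

record Iso {N M : ℕ} (X : Graph N) (R : Fin M → Fin M → Set) : Set where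
  field
    bij      : Fin N ↔ Fin M
    preserve : ∀ x y → Adj X x y ⇔ R (Inverse.to bij x) (Inverse.to bij y)
open Iso public

Aut : {N : ℕ} → Graph N → Set
Aut X = Iso X (Adj X)

app : {N : ℕ} {X : Graph N} → Aut X → Fin N → Fin N
app σ = Inverse.to (bij σ)

VertexTransitive : {N : ℕ} → Graph N → Set
VertexTransitive X = ∀ x y → Σ (Aut X) λ σ → app σ x ≡ y

iter : {A : Set} → (A → A) → ℕ → A → A
iter f zero    x = x
iter f (suc i) x = f (iter f i x)

IsFactorPartition : {N : ℕ} → Graph N → (M F : Fin N → Fin N → Set) → Set
IsFactorPartition X M F =
  (∀ {x y} → M x y → M y x) × (∀ {x y} → F x y → F y x) ×
  (∀ {x y} → M x y → Adj X x y) × (∀ {x y} → F x y → Adj X x y) ×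
  (∀ {x y} → Adj X x y → M x y ⊎ F x y) ×
  (∀ {x y} → M x y → F x y → ⊥) ×
  ExactlyOne M × ExactlyTwo F

AutInvariant : {N : ℕ} → (X : Graph N) → (M F : Fin N → Fin N → Set) → Set
AutInvariant X M F = ∀ (σ : Aut X) → ∀ x y →
  (M x y ⇔ M (app σ x) (app σ y)) × (F x y ⇔ F (app σ x) (app σ y))

Step : (n : ℕ) .{{_ : NonZero n}} → ℕ → Fin n → Fin n → Set
Step n d i j = toℕ j ≡ (toℕ i + d) % n ⊎ toℕ i ≡ (toℕ j + d) % n

-- c is an injective cyclic labelling c(0),…,c(n-1) of an n-cycle; the
-- edges of the cycle are the pairs {c(i), c(i+1 mod n)}
CycleEdge : {N : ℕ} (n : ℕ) .{{_ : NonZero n}} → (Fin n → Fin N) →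
            Fin N → Fin N → Set
CycleEdge n c x y = ∃[ i ] ∃[ j ] (Step n 1 i j × c i ≡ x × c j ≡ y)

Injective : {A B : Set} → (A → B) → Set
Injective f = ∀ {a b} → f a ≡ f b → a ≡ b

-- F consists of exactly two (vertex-disjoint, spanning) n-cycles C₁, C₂,
-- labelled cyclically by c₁ and c₂
TwoNCycles : {N : ℕ} (n : ℕ) .{{_ : NonZero n}} → (F : Fin N → Fin N → Set) →
             (c₁ c₂ : Fin n → Fin N) → Set
TwoNCycles n F c₁ c₂ =
  Injective c₁ × Injective c₂ ×
  (∀ i j → c₁ i ≢ c₂ j) ×
  (∀ x → (∃[ i ] c₁ i ≡ x) ⊎ (∃[ i ] c₂ i ≡ x)) ×
  (∀ x y → F x y ⇔ (CycleEdge n c₁ x y ⊎ CycleEdge n c₂ x y))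

InImage : {N n : ℕ} → (Fin n → Fin N) → Fin N → Set
InImage c x = ∃[ i ] c i ≡ x

-- H (restrictions to U of elements of the setwise stabiliser Aut(X)_{U})
-- contains an n-cycle: some automorphism σ with σ(U) = U acts on U as an
-- n-cycle, i.e. there is u ∈ U such that u, σu, …, σ^{n-1}u are pairwise
-- distinct and exhaust U.
HContainsNCycle : {N : ℕ} (n : ℕ) → (X : Graph N) → (U : Fin N → Set) → Set
HContainsNCycle n X U = Σ (Aut X) λ σ →
  (∀ x → U x ⇔ U (app σ x)) ×
  ∃[ u ] (U u ×
    (∀ (i j : Fin n) → iter (app σ) (toℕ i) u ≡ iter (app σ) (toℕ j) u → i ≡ j) ×
    (∀ x → U x → ∃[ i ] (iter (app σ) (toℕ {n} i) u ≡ x)))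

-- Generalized Petersen graph GP(n,k) on Fin (n + n):
-- u_i = i ↑ˡ n (first block), v_i = n ↑ʳ i (second block)

GPAdj : (n : ℕ) .{{_ : NonZero n}} → ℕ → Fin (n + n) → Fin (n + n) → Set
GPAdj n k x y with splitAt n x | splitAt n y
... | inj₁ i | inj₁ j = Step n 1 i j
... | inj₁ i | inj₂ j = i ≡ j
... | inj₂ i | inj₁ j = i ≡ j
... | inj₂ i | inj₂ j = Step n k i j

-- σ maps C₁ onto itself and respects both factors, so on C₁ = u₀ … u₍ₙ₋₁₎ it
-- is a rotation or a reflection; a reflection is an involution, hence σ is a
-- rotation u_l ↦ u_{l+r}, and because it is an n-cycle some power τ of σ is
-- the unit rotation u_l ↦ u_{l+1}. If the 1-factor joined two vertices of C₁,
-- the powers of τ would make V(C₁) closed under every edge, contradicting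
-- connectivity; so v_l := partner of u_l runs over C₂ and τ v_l = v_{l+1}.
-- Translating by powers of τ, the C₂-neighbours of v_l are v_{l±p} for one
-- fixed p, and choosing k ≡ ±p with 2k < n exhibits X as GP(n,k).

module Submission where

open import Data.Fin using (Fin; toℕ; fromℕ<; splitAt; punchOut)
open import Data.Fin.Properties
  using (+↔⊎; toℕ-injective; toℕ-fromℕ<; toℕ<n; any?; _≟_; pigeonhole; punchOut-injective)
open import Data.List using (_∷_; [])
open import Data.Nat
  using (ℕ; zero; suc; pred; _+_; _*_; _∸_; _%_; _/_; _≤_; _<_; NonZero; z≤n; s≤s; >-nonZero⁻¹)
open import Data.Nat.DivMod
open import Data.Nat.Properties hiding (_≟_)
open import Data.Nat.Tactic.RingSolver using (solve)
open import Data.Product using (∃-syntax; ∃₂; _×_; _,_; proj₁; proj₂)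
open import Data.Sum using (_⊎_; inj₁; inj₂; map; [_,_]′)
open import Function.Base using (_∘_; id)
open import Function.Bundles using (_⇔_; mk⇔; _↔_; mk↔ₛ′; Equivalence; Injection; Inverse)
open import Function.Properties.Equivalence using (⇔-setoid)
open import Function.Properties.Inverse using (↔⇒↣; ↔-sym)
open import Function.Construct.Composition using (_⇔-∘_)
open import Level using (0ℓ)
open import Relation.Binary.Bundles using (Setoid)
open import Relation.Binary.Construct.Closure.ReflexiveTransitive using (fold)
open import Relation.Binary.Definitions using (tri<; tri≈; tri>)
open import Relation.Binary.PropositionalEquality
  using (_≡_; _≢_; refl; sym; trans; cong; subst; subst₂; cong₂; module ≡-Reasoning)
open import Relation.Binary.Structures using (IsEquivalence)
open import Relation.Nullary using (¬_; contradiction; yes; no)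
import Relation.Binary.Reasoning.Setoid

open import Defs hiding (sym)

module ⇔-Reasoning = Relation.Binary.Reasoning.Setoid (⇔-setoid 0ℓ)

module Modular (n : ℕ) .{{_ : NonZero n}} where

  -- A record, so that both sides of a congruence stay visible to unification.
  infix 4 _≈_ _≉_
  record _≈_ (x y : ℕ) : Set where
    constructor reduce
    field reduced : x % n ≡ y % n

  _≉_ : ℕ → ℕ → Set
  x ≉ y = ¬ x ≈ y

  ≈-isEquivalence : IsEquivalence _≈_
  ≈-isEquivalence = record
    { refl  = reduce refl
    ; sym   = λ (reduce e) → reduce (sym e)
    ; trans = λ (reduce e) (reduce f) → reduce (trans e f)
    }

  ≈-setoid : Setoid _ _
  ≈-setoid = record { isEquivalence = ≈-isEquivalence }

  open IsEquivalence ≈-isEquivalence public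
    using () renaming (refl to ≈-refl; sym to ≈-sym; trans to ≈-trans; reflexive to ≡⇒≈)
  module ≈-Reasoning = Relation.Binary.Reasoning.Setoid ≈-setoid

  %-≈ : ∀ x → x % n ≈ x
  %-≈ x = reduce (m%n%n≡m%n x n)

  0%n≡0 : 0 % n ≡ 0
  0%n≡0 = m<n⇒m%n≡m (>-nonZero⁻¹ n)

  *n≈0 : ∀ k → k * n ≈ 0
  *n≈0 k = reduce (trans (m*n%n≡0 k n) (sym 0%n≡0))

  n≈0 : n ≈ 0
  n≈0 = ≈-trans (≡⇒≈ (sym (*-identityˡ n))) (*n≈0 1)

  +-congʳ : ∀ {x y} k → x ≈ y → x + k ≈ y + k
  +-congʳ {x} {y} k (reduce e) = reduce (begin
      (x + k) % n           ≡⟨ %-distribˡ-+ x k n ⟩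
      (x % n + k % n) % n   ≡⟨ cong (λ t → (t + k % n) % n) e ⟩
      (y % n + k % n) % n   ≡⟨ %-distribˡ-+ y k n ⟨
      (y + k) % n           ∎)
    where open ≡-Reasoning

  +-congˡ : ∀ k {x y} → x ≈ y → k + x ≈ k + y
  +-congˡ k {x} {y} e = begin
    k + x  ≡⟨ +-comm k x ⟩
    x + k  ≈⟨ +-congʳ k e ⟩
    y + k  ≡⟨ +-comm y k ⟩
    k + y  ∎
    where open ≈-Reasoning

  *-congˡ : ∀ k {x y} → x ≈ y → k * x ≈ k * y
  *-congˡ zero    e = ≈-refl
  *-congˡ (suc k) {x} {y} e = begin
    x + k * x  ≈⟨ +-congʳ (k * x) e ⟩
    y + k * x  ≈⟨ +-congˡ y (*-congˡ k e) ⟩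
    y + k * y  ∎
    where open ≈-Reasoning

  -- (n - 1) · x: negation modulo n without truncated subtraction.
  infix 8 -_
  -_ : ℕ → ℕ
  - x = pred n * x

  +-inverseʳ : ∀ x → x + - x ≈ 0
  +-inverseʳ x = begin
    x + pred n * x  ≡⟨ cong (_* x) (suc-pred n) ⟩
    n * x           ≡⟨ *-comm n x ⟩
    x * n           ≈⟨ *n≈0 x ⟩
    0               ∎
    where open ≈-Reasoning

  +-inverseˡ : ∀ x → - x + x ≈ 0
  +-inverseˡ x = ≈-trans (≡⇒≈ (+-comm (- x) x)) (+-inverseʳ x)

  x+k-k≈x : ∀ x k → x + k + - k ≈ x
  x+k-k≈x x k = begin
    x + k + - k    ≡⟨ +-assoc x k (- k) ⟩
    x + (k + - k)  ≈⟨ +-congˡ x (+-inverseʳ k) ⟩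
    x + 0          ≡⟨ +-identityʳ x ⟩
    x              ∎
    where open ≈-Reasoning

  +-cancelʳ : ∀ {x y} k → x + k ≈ y + k → x ≈ y
  +-cancelʳ {x} {y} k e = begin
    x            ≈⟨ x+k-k≈x x k ⟨
    x + k + - k  ≈⟨ +-congʳ (- k) e ⟩
    y + k + - k  ≈⟨ x+k-k≈x y k ⟩
    y            ∎
    where open ≈-Reasoning

  +-cancelˡ : ∀ k {x y} → k + x ≈ k + y → x ≈ y
  +-cancelˡ k {x} {y} e =
    +-cancelʳ k (≈-trans (≡⇒≈ (+-comm x k)) (≈-trans e (≡⇒≈ (+-comm k y))))

  inverseʳ-unique : ∀ {x y} → x + y ≈ 0 → y ≈ - x
  inverseʳ-unique {x} {y} e = +-cancelˡ x (≈-trans e (≈-sym (+-inverseʳ x)))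

  -‿involutive : ∀ x → - - x ≈ x
  -‿involutive x = ≈-sym (inverseʳ-unique (+-inverseˡ x))

  -‿distrib-+ : ∀ x y → - (x + y) ≡ - x + - y
  -‿distrib-+ x y = *-distribˡ-+ (pred n) x y

  x*-1≡-x : ∀ x → x * - 1 ≡ - x
  x*-1≡-x x = trans (cong (x *_) (*-identityʳ (pred n))) (*-comm x (pred n))

  b≈a-d⇒a≈b+d : ∀ {a b d} → b ≈ a + - d → a ≈ b + d
  b≈a-d⇒a≈b+d {a} {b} {d} e = begin
    a               ≈⟨ x+k-k≈x a (- d) ⟨
    a + - d + - - d ≈⟨ +-congˡ (a + - d) (-‿involutive d) ⟩
    a + - d + d     ≈⟨ +-congʳ d e ⟨
    b + d           ∎
    where open ≈-Reasoning

  b≈a+d⇒a≈b-d : ∀ {a b d} → b ≈ a + d → a ≈ b + - d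
  b≈a+d⇒a≈b-d {a} {b} {d} e = b≈a-d⇒a≈b+d (≈-trans e (+-congˡ a (≈-sym (-‿involutive d))))

  a+[b-a]≈b : ∀ a b → a + (b + - a) ≈ b
  a+[b-a]≈b a b = begin
    a + (b + - a)  ≡⟨ +-comm a (b + - a) ⟩
    b + - a + a    ≡⟨ +-assoc b (- a) a ⟩
    b + (- a + a)  ≈⟨ +-congˡ b (+-inverseˡ a) ⟩
    b + 0          ≡⟨ +-identityʳ b ⟩
    b              ∎
    where open ≈-Reasoning

  b-a≈d⇒b≈a+d : ∀ {a b d} → b + - a ≈ d → b ≈ a + d
  b-a≈d⇒b≈a+d {a} {b} e = ≈-trans (≈-sym (a+[b-a]≈b a b)) (+-congˡ a e)

  Near : ℕ → ℕ → ℕ → Set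
  Near d a b = b ≈ a + d ⊎ a ≈ b + d

  Near-resp-≈ : ∀ {d a a' b b'} → a ≈ a' → b ≈ b' → Near d a b → Near d a' b'
  Near-resp-≈ {d} a≈a' b≈b' (inj₁ e) = inj₁ (≈-trans (≈-sym b≈b') (≈-trans e (+-congʳ d a≈a')))
  Near-resp-≈ {d} a≈a' b≈b' (inj₂ e) = inj₂ (≈-trans (≈-sym a≈a') (≈-trans e (+-congʳ d b≈b')))

  Near⇔± : ∀ {d a b} → Near d a b ⇔ (b ≈ a + d ⊎ b ≈ a + - d)
  Near⇔± = mk⇔ (map id b≈a+d⇒a≈b-d) (map id b≈a-d⇒a≈b+d)

  Near-resp-offset : ∀ {d k a b} → d ≈ k → Near d a b → Near k a b
  Near-resp-offset {a = a} {b} d≈k =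
    map (λ e → ≈-trans e (+-congˡ a d≈k)) (λ e → ≈-trans e (+-congˡ b d≈k))

  Near-neg : ∀ {d a b} → Near d a b → Near (- d) a b
  Near-neg (inj₁ e) = inj₂ (b≈a+d⇒a≈b-d e)
  Near-neg (inj₂ e) = inj₁ (b≈a+d⇒a≈b-d e)

  Near-resp-± : ∀ {d k a b} → k ≈ d ⊎ k ≈ - d → Near d a b → Near k a b
  Near-resp-± (inj₁ k≈d)  = Near-resp-offset (≈-sym k≈d)
  Near-resp-± (inj₂ k≈-d) = Near-resp-offset (≈-sym k≈-d) ∘ Near-neg

  Near-⇔ : ∀ {d k a b} → k ≈ d ⊎ k ≈ - d → Near d a b ⇔ Near k a b
  Near-⇔ {d} {k} k≈±d = mk⇔ (Near-resp-± k≈±d) (Near-resp-± (±-sym k≈±d))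
    where
    ±-sym : k ≈ d ⊎ k ≈ - d → d ≈ k ⊎ d ≈ - k
    ±-sym (inj₁ e) = inj₁ (≈-sym e)
    ±-sym (inj₂ e) = inj₂ (≈-trans (≈-sym (-‿involutive d)) (*-congˡ (pred n) (≈-sym e)))

  toℕ%n : ∀ (i : Fin n) → toℕ i % n ≡ toℕ i
  toℕ%n i = m<n⇒m%n≡m (toℕ<n i)

  Step⇔Near : ∀ {d} {i j : Fin n} → Step n d i j ⇔ Near d (toℕ i) (toℕ j)
  Step⇔Near = mk⇔ (map (reduce ∘ to≈) (reduce ∘ to≈)) (map from≈ from≈)
    where
    to≈ : ∀ {i : Fin n} {x} → toℕ i ≡ x % n → toℕ i % n ≡ x % n
    to≈ {i} e = trans (toℕ%n i) e
    from≈ : ∀ {i : Fin n} {x} → toℕ i ≈ x → toℕ i ≡ x % n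
    from≈ {i} (reduce e) = trans (sym (toℕ%n i)) e

  toℕ-mod : ∀ x → toℕ (x mod n) ≈ x
  toℕ-mod x = ≈-trans (≡⇒≈ (toℕ-fromℕ< (m%n<n x n))) (%-≈ x)

  mod-cong : ∀ {x y} → x ≈ y → x mod n ≡ y mod n
  mod-cong {x} {y} (reduce e) =
    toℕ-injective (trans (toℕ-fromℕ< (m%n<n x n)) (trans e (sym (toℕ-fromℕ< (m%n<n y n)))))

  mod-injective : ∀ {x y} → x mod n ≡ y mod n → x ≈ y
  mod-injective {x} {y} e = ≈-trans (≈-sym (toℕ-mod x)) (≈-trans (≡⇒≈ (cong toℕ e)) (toℕ-mod y))

  toℕ-mod-inverse : ∀ (i : Fin n) → toℕ i mod n ≡ i
  toℕ-mod-inverse i = toℕ-injective (trans (toℕ-fromℕ< (m%n<n (toℕ i) n)) (toℕ%n i))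

  2≉0 : 3 ≤ n → 2 ≉ 0
  2≉0 3≤n (reduce e) with trans (sym (m<n⇒m%n≡m 3≤n)) (trans e 0%n≡0)
  ... | ()

  %≢0 : ∀ {x} → x ≉ 0 → x % n ≢ 0
  %≢0 x≉0 e = x≉0 (reduce (trans e (sym 0%n≡0)))

  2*x≡x+x : ∀ x → 2 * x ≡ x + x
  2*x≡x+x x = cong (x +_) (+-identityʳ x)

  -- The quotient of x % n + x % n by n can only be 1, as 0 < x % n < n.
  x+x≈0⇒x%n+x%n≡n : ∀ {x} → x ≉ 0 → x + x ≈ 0 → x % n + x % n ≡ n
  x+x≈0⇒x%n+x%n≡n {x} x≉0 (reduce e) with (x % n + x % n) / n | m≡m%n+[m/n]*n (x % n + x % n) n
  ... | q | divmod rewrite trans (sym (%-distribˡ-+ x x n)) (trans e 0%n≡0) with q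
  ... | zero        = contradiction (m+n≡0⇒m≡0 (x % n) divmod) (%≢0 x≉0)
  ... | suc zero    = trans divmod (+-identityʳ n)
  ... | suc (suc q) = contradiction divmod (<⇒≢ (<-≤-trans r+r<n+n (+-monoʳ-≤ n (m≤m+n n (q * n)))))
    where r+r<n+n = +-mono-< (m%n<n x n) (m%n<n x n)

  +-self-inverse-unique : ∀ {x y} → x ≉ 0 → y ≉ 0 → x + x ≈ 0 → y + y ≈ 0 → x ≈ y
  +-self-inverse-unique {x} {y} x≉0 y≉0 2x≈0 2y≈0 = reduce (*-cancelˡ-≡ (x % n) (y % n) 2 (begin
    2 * (x % n)    ≡⟨ 2*x≡x+x (x % n) ⟩
    x % n + x % n  ≡⟨ x+x≈0⇒x%n+x%n≡n x≉0 2x≈0 ⟩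
    n              ≡⟨ x+x≈0⇒x%n+x%n≡n y≉0 2y≈0 ⟨
    y % n + y % n  ≡⟨ 2*x≡x+x (y % n) ⟨
    2 * (y % n)    ∎))
    where open ≡-Reasoning

  small-representative : ∀ {d} → d ≉ 0 → d + d ≉ 0 →
                         ∃[ k ] (1 ≤ k × 2 * k < n × (k ≈ d ⊎ k ≈ - d))
  small-representative {d} d≉0 2d≉0 with <-cmp (2 * (d % n)) n
  ... | tri< 2r<n _ _ = d % n , n≢0⇒n>0 (%≢0 d≉0) , 2r<n , inj₁ (%-≈ d)
  ... | tri≈ _ 2r≡n _ = contradiction 2d≈0 2d≉0
    where
    2d≈0 : d + d ≈ 0
    2d≈0 = reduce (begin
      (d + d) % n              ≡⟨ %-distribˡ-+ d d n ⟩
      (d % n + d % n) % n      ≡⟨ cong (_% n) (trans (sym (2*x≡x+x (d % n))) 2r≡n) ⟩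
      n % n                    ≡⟨ n%n≡0 n ⟩
      0                        ≡⟨ 0%n≡0 ⟨
      0 % n                    ∎)
      where open ≡-Reasoning
  ... | tri> _ _ n<2r = k , m<n⇒0<n∸m r<n , 2k<n , inj₂ (inverseʳ-unique d+k≈0)
    where
    r = d % n
    k = n ∸ r
    r<n = m%n<n d n
    r+k≡n : r + k ≡ n
    r+k≡n = m+[n∸m]≡n (<⇒≤ r<n)
    k<r : k < r
    k<r = +-cancelˡ-< r k r (subst (_< r + r) (sym r+k≡n) (subst (n <_) (2*x≡x+x r) n<2r))
    2k<n : 2 * k < n
    2k<n = subst₂ _<_ (sym (2*x≡x+x k)) (trans (+-comm k r) r+k≡n) (+-monoʳ-< k k<r)
    d+k≈0 : d + k ≈ 0
    d+k≈0 = ≈-trans (+-congʳ k (≈-sym (%-≈ d))) (≈-trans (≡⇒≈ r+k≡n) n≈0)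

module _ {A : Set} (f : A → A) where

  iter-injective : Injective f → ∀ t → Injective (iter f t)
  iter-injective inj zero    e = e
  iter-injective inj (suc t) e = iter-injective inj t (inj e)

  iter-preserves : (R : A → A → Set) → (∀ {x y} → R x y → R (f x) (f y)) →
                   ∀ t {x y} → R x y → R (iter f t x) (iter f t y)
  iter-preserves R pres zero    r = r
  iter-preserves R pres (suc t) r = pres (iter-preserves R pres t r)

  iter-commutes : (g : A → A) → (∀ x → f (g x) ≡ g (f x)) →
                  ∀ t x → iter f t (g x) ≡ g (iter f t x)
  iter-commutes g comm zero    x = refl
  iter-commutes g comm (suc t) x = trans (cong f (iter-commutes g comm t x)) (comm (iter f t x))

module Partner {N : ℕ} {R : Fin N → Fin N → Set}
               (R-sym : ∀ {x y} → R x y → R y x) (R-one : ExactlyOne R) where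

  partner : Fin N → Fin N
  partner x = proj₁ (R-one x)

  partner-related : ∀ x → R x (partner x)
  partner-related x = proj₁ (proj₂ (R-one x))

  partner-unique : ∀ {x y} → R x y → y ≡ partner x
  partner-unique {x} {y} r = proj₂ (proj₂ (R-one x)) y r

  partner-involutive : ∀ x → partner (partner x) ≡ x
  partner-involutive x = sym (partner-unique (R-sym (partner-related x)))

  partner-injective : Injective partner
  partner-injective {x} {y} e =
    trans (sym (partner-involutive x)) (trans (cong partner e) (partner-involutive y))

injective⇒surjective : ∀ {k} (f : Fin k → Fin k) → Injective f → ∀ j → ∃[ i ] f i ≡ j
injective⇒surjective {suc k} f f-inj j with any? (λ i → f i ≟ j)
... | yes hit  = hit
... | no  miss = collision-impossible (pigeonhole (n<1+n k) (λ i → punchOut (avoids i)))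
  where
  avoids : ∀ i → j ≢ f i
  avoids i e = miss (i , sym e)
  collision-impossible : ∃₂ (λ i i' → toℕ i < toℕ i' × punchOut (avoids i) ≡ punchOut (avoids i')) →
                         ∃[ i ] f i ≡ j
  collision-impossible (i , i' , i<i' , same) =
    contradiction (cong toℕ (f-inj (punchOut-injective (avoids i) (avoids i') same))) (<⇒≢ i<i')

injective⇒↔ : ∀ {k} (f : Fin k → Fin k) → Injective f → Fin k ↔ Fin k
injective⇒↔ f f-inj = mk↔ₛ′ f (proj₁ ∘ surj) (proj₂ ∘ surj) (λ i → f-inj (proj₂ (surj (f i))))
  where surj = injective⇒surjective f f-inj

module GeneralisedPetersen
  (n : ℕ) .{{_ : NonZero n}} (3≤n : 3 ≤ n)
  (X : Graph (n + n)) (connected : Connected X)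
  (M F : Fin (n + n) → Fin (n + n) → Set)
  (M-sym : ∀ {x y} → M x y → M y x) (F-sym : ∀ {x y} → F x y → F y x)
  (M⊆X : ∀ {x y} → M x y → Adj X x y) (F⊆X : ∀ {x y} → F x y → Adj X x y)
  (X⊆M⊎F : ∀ {x y} → Adj X x y → M x y ⊎ F x y)
  (M-one : ExactlyOne M) (F-two : ExactlyTwo F) (invariant : AutInvariant X M F)
  (c₁ c₂ : Fin n → Fin (n + n)) (c₁-injective : Injective c₁)
  (C₁∩C₂≡∅ : ∀ i j → c₁ i ≢ c₂ j)
  (F⇔cycles : ∀ x y → F x y ⇔ (CycleEdge n c₁ x y ⊎ CycleEdge n c₂ x y))
  (σ : Aut X) (σ-stabilises : ∀ x → InImage c₁ x → InImage c₁ (app σ x))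
  (u* : Fin (n + n)) (u*∈C₁ : InImage c₁ u*)
  (orbit-injective : ∀ (i j : Fin n) → iter (app σ) (toℕ i) u* ≡ iter (app σ) (toℕ j) u* → i ≡ j)
  (orbit-covers : ∀ x → InImage c₁ x → ∃[ i ] iter (app σ) (toℕ {n} i) u* ≡ x)
  where

  open Modular n
  open Partner M-sym M-one renaming (partner to m)

  V : Set
  V = Fin (n + n)

  U : V → Set
  U = InImage c₁

  record FactorPreserving (f : V → V) : Set where
    field
      injective        : Injective f
      preserves-F      : ∀ {x y} → F x y → F (f x) (f y)
      commutes-partner : ∀ x → f (m x) ≡ m (f x)
  open FactorPreserving

  iter-FactorPreserving : ∀ {f} → FactorPreserving f → ∀ t → FactorPreserving (iter f t)
  iter-FactorPreserving {f} fp t = record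
    { injective        = iter-injective f (injective fp) t
    ; preserves-F      = iter-preserves f F (preserves-F fp) t
    ; commutes-partner = iter-commutes f m (commutes-partner fp) t
    }

  aut-FactorPreserving : (τ : Aut X) → FactorPreserving (app τ)
  aut-FactorPreserving τ = record
    { injective        = Injection.injective (↔⇒↣ (bij τ))
    ; preserves-F      = λ {x} {y} → Equivalence.to (proj₂ (invariant τ x y))
    ; commutes-partner = λ x → partner-unique (Equivalence.to (proj₁ (invariant τ x (m x))) (partner-related x))
    }

  c₁-edge⇔Step : ∀ i j → F (c₁ i) (c₁ j) ⇔ Step n 1 i j
  c₁-edge⇔Step i j = mk⇔ to (λ st → Equivalence.from (F⇔cycles _ _) (inj₁ (i , j , st , refl , refl)))
    where
    to : F (c₁ i) (c₁ j) → Step n 1 i j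
    to h with Equivalence.to (F⇔cycles _ _) h
    ... | inj₁ (i' , j' , st , i'≡i , j'≡j)
      rewrite c₁-injective i'≡i | c₁-injective j'≡j = st
    ... | inj₂ (i' , _ , _ , c₂i'≡c₁i , _) = contradiction (sym c₂i'≡c₁i) (C₁∩C₂≡∅ i i')

  C₁-closed : ∀ {x y} → U x → F x y → U y
  C₁-closed (i , refl) h with Equivalence.to (F⇔cycles _ _) h
  ... | inj₁ (_ , j , _ , _ , c₁j≡y) = j , c₁j≡y
  ... | inj₂ (i' , _ , _ , c₂i'≡c₁i , _) = contradiction (sym c₂i'≡c₁i) (C₁∩C₂≡∅ i i')

  u : ℕ → V
  u l = c₁ (l mod n)

  u∈C₁ : ∀ l → U (u l)
  u∈C₁ l = l mod n , refl

  u-cong : ∀ {a b} → a ≈ b → u a ≡ u b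
  u-cong e = cong c₁ (mod-cong e)

  u-injective : ∀ {a b} → u a ≡ u b → a ≈ b
  u-injective e = mod-injective (c₁-injective e)

  c₁≡u : ∀ i → c₁ i ≡ u (toℕ i)
  c₁≡u i = cong c₁ (sym (toℕ-mod-inverse i))

  C₁⇒u : ∀ {x} → U x → ∃[ l ] x ≡ u l
  C₁⇒u (i , refl) = toℕ i , c₁≡u i

  u-edge⇔Near : ∀ {a b} → F (u a) (u b) ⇔ Near 1 a b
  u-edge⇔Near {a} {b} = begin
    F (u a) (u b)                          ≈⟨ c₁-edge⇔Step (a mod n) (b mod n) ⟩
    Step n 1 (a mod n) (b mod n)           ≈⟨ Step⇔Near ⟩
    Near 1 (toℕ (a mod n)) (toℕ (b mod n)) ≈⟨ mk⇔ (Near-resp-≈ (toℕ-mod a) (toℕ-mod b))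
                                                  (Near-resp-≈ (≈-sym (toℕ-mod a)) (≈-sym (toℕ-mod b))) ⟩
    Near 1 a b                             ∎
    where open ⇔-Reasoning

  u-neighbours : ∀ {d a y} → d ≈ 1 ⊎ d ≈ - 1 → F (u a) y → y ≡ u (a + d) ⊎ y ≡ u (a + - d)
  u-neighbours {d} {a} d≈±1 h with C₁⇒u (C₁-closed (u∈C₁ a) h)
  ... | b , refl = map u-cong u-cong (Equivalence.to Near⇔± (Near-resp-± d≈±1 (Equivalence.to u-edge⇔Near h)))

  module _ {f : V → V} (fp : FactorPreserving f) {d a₀ : ℕ} (d≈±1 : d ≈ 1 ⊎ d ≈ - 1)
           (f-u₀ : f (u 0) ≡ u a₀) (f-u₁ : f (u 1) ≡ u (a₀ + d)) where

    -- Two consecutive images fix the direction; the alternative neighbour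
    -- would make f identify u l and u (2 + l).
    rigid : ∀ l → f (u l) ≡ u (a₀ + l * d)
    rigid l = proj₁ (consecutive l)
      where
      consecutive : ∀ l → f (u l) ≡ u (a₀ + l * d) × f (u (suc l)) ≡ u (a₀ + suc l * d)
      consecutive zero =
        trans f-u₀ (cong u (sym (+-identityʳ a₀))) , trans f-u₁ (cong (λ t → u (a₀ + t)) (sym (+-identityʳ d)))
      consecutive (suc l) with consecutive l
      ... | f-ul , f-usl = f-usl , f-ussl
        where
        edge : F (u (a₀ + suc l * d)) (f (u (suc (suc l))))
        edge = subst (λ x → F x (f (u (suc (suc l))))) f-usl
                 (preserves-F fp (Equivalence.from u-edge⇔Near (inj₁ (≡⇒≈ (+-comm 1 (suc l))))))
        f-ussl : f (u (suc (suc l))) ≡ u (a₀ + suc (suc l) * d)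
        f-ussl with u-neighbours d≈±1 edge
        ... | inj₁ e = trans e (cong u (solve (a₀ ∷ l ∷ d ∷ [])))
        ... | inj₂ e = contradiction 2≈0 (2≉0 3≤n)
          where
          unfold : a₀ + suc l * d ≡ a₀ + l * d + d
          unfold = solve (a₀ ∷ l ∷ d ∷ [])
          back : a₀ + suc l * d + - d ≈ a₀ + l * d
          back = ≈-trans (≡⇒≈ (cong (_+ - d) unfold)) (x+k-k≈x (a₀ + l * d) d)
          2≈0 : 2 ≈ 0
          2≈0 = +-cancelˡ l (≈-trans (≡⇒≈ (+-comm l 2)) (≈-trans
                  (u-injective (injective fp (trans e (trans (u-cong back) (sym f-ul)))))
                  (≡⇒≈ (sym (+-identityʳ l)))))

  s : V → V
  s = app σ

  σ-fp : FactorPreserving s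
  σ-fp = aut-FactorPreserving σ

  orbit-no-early-return : ∀ t → 0 < t → t < n → iter s t u* ≢ u*
  orbit-no-early-return t 0<t t<n e = <⇒≢ 0<t (begin
    0                        ≡⟨ toℕ-fromℕ< 0<n ⟨
    toℕ (fromℕ< 0<n)         ≡⟨ cong toℕ (orbit-injective (fromℕ< 0<n) (fromℕ< t<n) same) ⟩
    toℕ (fromℕ< t<n)         ≡⟨ toℕ-fromℕ< t<n ⟩
    t                        ∎)
    where
    open ≡-Reasoning
    0<n = <-trans 0<t t<n
    same : iter s (toℕ (fromℕ< 0<n)) u* ≡ iter s (toℕ (fromℕ< t<n)) u*
    same = subst₂ (λ a b → iter s a u* ≡ iter s b u*) (sym (toℕ-fromℕ< 0<n)) (sym (toℕ-fromℕ< t<n)) (sym e)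

  -- A reflection of C₁ is an involution, so it cannot act on U as an n-cycle.
  σ-rotates : ∃[ r ] ∀ l → s (u l) ≡ u (l + r)
  σ-rotates with C₁⇒u (σ-stabilises (u 0) (u∈C₁ 0))
  ... | a₀ , σu₀ with u-neighbours (inj₁ ≈-refl) (subst (λ x → F x (s (u 1))) σu₀
                        (preserves-F σ-fp (Equivalence.from u-edge⇔Near (inj₁ ≈-refl))))
  ... | inj₁ σu₁ = a₀ , λ l → trans (rigid σ-fp (inj₁ ≈-refl) σu₀ σu₁ l)
                                     (cong u (trans (cong (a₀ +_) (*-identityʳ l)) (+-comm a₀ l)))
  ... | inj₂ σu₁ = contradiction σ²u*≡u* (orbit-no-early-return 2 (s≤s z≤n) 3≤n)
    where
    reflect : ∀ l → s (u l) ≡ u (a₀ + - l)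
    reflect l = trans (rigid σ-fp (inj₂ ≈-refl) σu₀ σu₁ l) (cong (λ t → u (a₀ + t)) (x*-1≡-x l))
    e = proj₁ (C₁⇒u u*∈C₁)
    σ²u*≡u* : s (s u*) ≡ u*
    σ²u*≡u* = begin
      s (s u*)                  ≡⟨ cong (s ∘ s) (proj₂ (C₁⇒u u*∈C₁)) ⟩
      s (s (u e))               ≡⟨ cong s (reflect e) ⟩
      s (u (a₀ + - e))          ≡⟨ reflect (a₀ + - e) ⟩
      u (a₀ + - (a₀ + - e))     ≡⟨ u-cong (≈-trans (≡⇒≈ (cong (a₀ +_) (-‿distrib-+ a₀ (- e))))
                                     (≈-trans (≡⇒≈ (sym (+-assoc a₀ (- a₀) (- - e))))
                                     (≈-trans (+-congʳ (- - e) (+-inverseʳ a₀)) (-‿involutive e)))) ⟩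
      u e                       ≡⟨ proj₂ (C₁⇒u u*∈C₁) ⟨
      u*                        ∎
      where open ≡-Reasoning

  r : ℕ
  r = proj₁ σ-rotates

  σ^t-u : ∀ t l → iter s t (u l) ≡ u (l + t * r)
  σ^t-u zero    l = cong u (sym (+-identityʳ l))
  σ^t-u (suc t) l = begin
    s (iter s t (u l))   ≡⟨ cong s (σ^t-u t l) ⟩
    s (u (l + t * r))    ≡⟨ proj₂ σ-rotates (l + t * r) ⟩
    u (l + t * r + r)    ≡⟨ cong u (trans (+-assoc l (t * r) r) (cong (l +_) (+-comm (t * r) r))) ⟩
    u (l + suc t * r)    ∎
    where open ≡-Reasoning

  r-invertible : ∃[ t ] t * r ≈ 1
  r-invertible with C₁⇒u u*∈C₁
  ... | e , u*≡ue with orbit-covers (u (e + 1)) (u∈C₁ (e + 1))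
  ... | i , σⁱu*≡ = toℕ i , +-cancelˡ e (u-injective (begin
    u (e + toℕ i * r)    ≡⟨ σ^t-u (toℕ i) e ⟨
    iter s (toℕ i) (u e) ≡⟨ cong (iter s (toℕ i)) u*≡ue ⟨
    iter s (toℕ i) u*    ≡⟨ σⁱu*≡ ⟩
    u (e + 1)            ∎))
    where open ≡-Reasoning

  shift : ℕ → V → V
  shift c = iter s (c * proj₁ r-invertible)

  shift-fp : ∀ c → FactorPreserving (shift c)
  shift-fp c = iter-FactorPreserving σ-fp (c * proj₁ r-invertible)

  shift-u : ∀ c l → shift c (u l) ≡ u (l + c)
  shift-u c l = trans (σ^t-u (c * t) l) (u-cong (+-congˡ l (begin
    c * t * r    ≡⟨ *-assoc c t r ⟩
    c * (t * r)  ≈⟨ *-congˡ c (proj₂ r-invertible) ⟩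
    c * 1        ≡⟨ *-identityʳ c ⟩
    c            ∎)))
    where
    t = proj₁ r-invertible
    open ≈-Reasoning

  -- Otherwise U would be closed under both factors, hence under adjacency,
  -- and connectivity would put C₂ inside C₁.
  partner-leaves-C₁ : ∀ l → ¬ U (m (u l))
  partner-leaves-C₁ l₀ m-ul₀∈U = C₁∩C₂≡∅ _ _ (proj₂ (U-everything (c₂ (0 mod n))))
    where
    z = proj₁ (C₁⇒u m-ul₀∈U)
    partner-u : ∀ l → U (m (u l))
    partner-u l = subst U (sym (begin
      m (u l)                   ≡⟨ cong m (u-cong (a+[b-a]≈b l₀ l)) ⟨
      m (u (l₀ + (l + - l₀)))   ≡⟨ cong m (shift-u (l + - l₀) l₀) ⟨
      m (shift c (u l₀))        ≡⟨ commutes-partner (shift-fp c) (u l₀) ⟨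
      shift c (m (u l₀))        ≡⟨ cong (shift c) (proj₂ (C₁⇒u m-ul₀∈U)) ⟩
      shift c (u z)             ≡⟨ shift-u c z ⟩
      u (z + c)                 ∎)) (u∈C₁ (z + c))
      where
      c = l + - l₀
      open ≡-Reasoning
    U-adj-closed : ∀ {x y} → Adj X x y → U x → U y
    U-adj-closed h x∈U with X⊆M⊎F h | C₁⇒u x∈U
    ... | inj₁ mh | l , refl = subst U (sym (partner-unique mh)) (partner-u l)
    ... | inj₂ fh | _        = C₁-closed x∈U fh
    U-everything : ∀ y → U y
    U-everything y = fold (λ x y → U x → U y) (λ h k → k ∘ U-adj-closed h) id
                          (connected (c₁ (0 mod n)) y) (0 mod n , refl)

  partner-c₁∉C₁ : ∀ i → ¬ U (m (c₁ i))
  partner-c₁∉C₁ i = partner-leaves-C₁ (toℕ i) ∘ subst (U ∘ m) (c₁≡u i)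

  label : Fin n ⊎ Fin n → V
  label = [ c₁ , m ∘ c₁ ]′

  gp : Fin (n + n) → V
  gp = label ∘ splitAt n

  label-injective : Injective label
  label-injective {inj₁ i} {inj₁ j} e = cong inj₁ (c₁-injective e)
  label-injective {inj₁ i} {inj₂ j} e = contradiction (i , e) (partner-c₁∉C₁ j)
  label-injective {inj₂ i} {inj₁ j} e = contradiction (j , sym e) (partner-c₁∉C₁ i)
  label-injective {inj₂ i} {inj₂ j} e = cong inj₂ (c₁-injective (partner-injective e))

  gp-injective : Injective gp
  gp-injective = Injection.injective (↔⇒↣ (+↔⊎ {n} {n})) ∘ label-injective

  v : ℕ → V
  v l = m (u l)

  v-cong : ∀ {a b} → a ≈ b → v a ≡ v b
  v-cong = cong m ∘ u-cong

  v-injective : ∀ {a b} → v a ≡ v b → a ≈ b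
  v-injective = u-injective ∘ partner-injective

  shift-v : ∀ c l → shift c (v l) ≡ v (l + c)
  shift-v c l = trans (commutes-partner (shift-fp c) (u l)) (cong m (shift-u c l))

  F-neighbour-of-v : ∀ {a y} → F (v a) y → ∃[ b ] y ≡ v b
  F-neighbour-of-v {a} {y} h with injective⇒surjective gp gp-injective y
  ... | x , refl = on-label (splitAt n x) h
    where
    on-label : ∀ z → F (v a) (label z) → ∃[ b ] label z ≡ v b
    on-label (inj₁ i) h' = contradiction (C₁-closed (i , refl) (F-sym h')) (partner-leaves-C₁ a)
    on-label (inj₂ i) _  = toℕ i , cong m (c₁≡u i)

  record InnerOffsets : Set where
    field
      p p'     : ℕ
      p≉p'     : p ≉ p'
      F-p      : F (v 0) (v p)
      F-p'     : F (v 0) (v p')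
      only-p-p' : ∀ {w} → F (v 0) (v w) → w ≈ p ⊎ w ≈ p'

  inner-offsets : InnerOffsets
  inner-offsets with F-two (v 0)
  ... | α , β , α≢β , F-α , F-β , only with F-neighbour-of-v F-α | F-neighbour-of-v F-β
  ... | p , refl | p' , refl = record
    { p = p ; p' = p' ; p≉p' = α≢β ∘ v-cong ; F-p = F-α ; F-p' = F-β
    ; only-p-p' = map v-injective v-injective ∘ only _ }

  open InnerOffsets inner-offsets

  translate : ∀ {a b} → F (v a) (v b) → F (v 0) (v (b + - a))
  translate {a} {b} h = subst₂ F (trans (shift-v (- a) a) (v-cong (+-inverseʳ a))) (shift-v (- a) b)
                          (preserves-F (shift-fp (- a)) h)

  translate⁻¹ : ∀ {a w} → F (v 0) (v w) → F (v a) (v (w + a))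
  translate⁻¹ {a} {w} h = subst₂ F (shift-v a 0) (shift-v a w) (preserves-F (shift-fp a) h)

  F-irreflexive : ∀ {x} → ¬ F x x
  F-irreflexive = irrefl X ∘ F⊆X

  p≉0 : p ≉ 0
  p≉0 e = F-irreflexive (subst (F (v 0)) (v-cong e) F-p)

  p'≉0 : p' ≉ 0
  p'≉0 e = F-irreflexive (subst (F (v 0)) (v-cong e) F-p')

  -- If - p ≈ p, then - p' ∈ {p, p'} gives either p' ≈ p or two distinct
  -- nonzero solutions of x + x ≈ 0.
  -p≈p' : - p ≈ p'
  -p≈p' with only-p-p' (translate (F-sym F-p)) | only-p-p' (translate (F-sym F-p'))
  ... | inj₂ -p≈p' | _ = -p≈p'
  ... | inj₁ -p≈p | inj₁ -p'≈p = contradiction p≈p' p≉p'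
    where
    p≈p' : p ≈ p'
    p≈p' = ≈-trans (≈-sym -p≈p) (≈-trans (*-congˡ (pred n) (≈-sym -p'≈p)) (-‿involutive p'))
  ... | inj₁ -p≈p | inj₂ -p'≈p' =
    contradiction (+-self-inverse-unique p≉0 p'≉0 (self-inverse -p≈p) (self-inverse -p'≈p')) p≉p'
    where
    self-inverse : ∀ {x} → - x ≈ x → x + x ≈ 0
    self-inverse {x} -x≈x = ≈-trans (+-congˡ x (≈-sym -x≈x)) (+-inverseʳ x)

  p+p≉0 : p + p ≉ 0
  p+p≉0 e = p≉p' (≈-trans (inverseʳ-unique e) -p≈p')

  v-edge⇔Near : ∀ {a b} → F (v a) (v b) ⇔ Near p a b
  v-edge⇔Near {a} {b} = mk⇔ to from
    where
    to : F (v a) (v b) → Near p a b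
    to h = Equivalence.from Near⇔± (map b-a≈d⇒b≈a+d (λ e → b-a≈d⇒b≈a+d (≈-trans e (≈-sym -p≈p'))) (only-p-p' (translate h)))
    from : Near p a b → F (v a) (v b)
    from (inj₁ b≈a+p) = subst (F (v a)) (v-cong (≈-trans (≡⇒≈ (+-comm p a)) (≈-sym b≈a+p))) (translate⁻¹ F-p)
    from (inj₂ a≈b+p) = F-sym (subst (F (v b)) (v-cong (≈-trans (≡⇒≈ (+-comm p b)) (≈-sym a≈b+p))) (translate⁻¹ F-p))

  Adj⇔F : ∀ {x y} → ¬ M x y → Adj X x y ⇔ F x y
  Adj⇔F ¬M = mk⇔ (λ h → [ (λ mh → contradiction mh ¬M) , id ]′ (X⊆M⊎F h)) F⊆X

  module _ {k : ℕ} (k≈±p : k ≈ p ⊎ k ≈ - p) where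

    outer : ∀ i j → Adj X (c₁ i) (c₁ j) ⇔ Step n 1 i j
    outer i j = c₁-edge⇔Step i j ⇔-∘ Adj⇔F (λ mh → partner-c₁∉C₁ i (j , partner-unique mh))

    spoke : ∀ i j → Adj X (c₁ i) (m (c₁ j)) ⇔ (i ≡ j)
    spoke i j = mk⇔ to (λ { refl → M⊆X (partner-related (c₁ i)) })
      where
      to : Adj X (c₁ i) (m (c₁ j)) → i ≡ j
      to h with X⊆M⊎F h
      ... | inj₁ mh = sym (c₁-injective (partner-injective (partner-unique mh)))
      ... | inj₂ fh = contradiction (C₁-closed (i , refl) fh) (partner-c₁∉C₁ j)

    spoke′ : ∀ i j → Adj X (m (c₁ i)) (c₁ j) ⇔ (i ≡ j)
    spoke′ i j = mk⇔ (sym ∘ Equivalence.to (spoke j i) ∘ Graph.sym X)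
                     (Graph.sym X ∘ Equivalence.from (spoke j i) ∘ sym)

    inner : ∀ i j → Adj X (m (c₁ i)) (m (c₁ j)) ⇔ Step n k i j
    inner i j = begin
      Adj X (m (c₁ i)) (m (c₁ j))  ≈⟨ Adj⇔F ¬M ⟩
      F (m (c₁ i)) (m (c₁ j))      ≡⟨ cong₂ (λ x y → F (m x) (m y)) (c₁≡u i) (c₁≡u j) ⟩
      F (v (toℕ i)) (v (toℕ j))    ≈⟨ v-edge⇔Near ⟩
      Near p (toℕ i) (toℕ j)       ≈⟨ Near-⇔ k≈±p ⟩
      Near k (toℕ i) (toℕ j)       ≈⟨ Step⇔Near ⟨
      Step n k i j                 ∎
      where
      open ⇔-Reasoning
      ¬M : ¬ M (m (c₁ i)) (m (c₁ j))
      ¬M mh = partner-c₁∉C₁ j (i , sym (trans (partner-unique mh) (partner-involutive (c₁ i))))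

    gp-edge : ∀ x y → Adj X (gp x) (gp y) ⇔ GPAdj n k x y
    gp-edge x y with splitAt n x | splitAt n y
    ... | inj₁ i | inj₁ j = outer i j
    ... | inj₁ i | inj₂ j = spoke i j
    ... | inj₂ i | inj₁ j = spoke′ i j
    ... | inj₂ i | inj₂ j = inner i j

    iso : Iso X (GPAdj n k)
    iso = record
      { bij      = ↔-sym gp-↔
      ; preserve = λ x y → subst₂ (λ x′ y′ → Adj X x′ y′ ⇔ GPAdj n k (gp⁻¹ x) (gp⁻¹ y))
                                  (gp-gp⁻¹ x) (gp-gp⁻¹ y) (gp-edge (gp⁻¹ x) (gp⁻¹ y))
      }
      where
      gp-↔ = injective⇒↔ gp gp-injective
      gp⁻¹ = Inverse.from gp-↔
      gp-gp⁻¹ = Inverse.strictlyInverseˡ gp-↔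

  generalised-petersen : ∃[ k ] (1 ≤ k × 2 * k < n × Iso X (GPAdj n k))
  generalised-petersen with small-representative p≉0 p+p≉0
  ... | k , 1≤k , 2k<n , k≈±p = k , 1≤k , 2k<n , iso k≈±p

theorem3p2 : (n : ℕ) .{{_ : NonZero n}} → 3 ≤ n →
    (X : Graph (n + n)) → Connected X → Trivalent X → VertexTransitive X →
    (M F : Fin (n + n) → Fin (n + n) → Set) →
    IsFactorPartition X M F → AutInvariant X M F →
    (c₁ c₂ : Fin n → Fin (n + n)) → TwoNCycles n F c₁ c₂ →
    HContainsNCycle n X (InImage c₁) →
    ∃[ k ] (1 ≤ k × 2 * k < n × Iso X (GPAdj n k))
theorem3p2 n 3≤n X connected _ _ M F
           (M-sym , F-sym , M⊆X , F⊆X , X⊆M⊎F , _ , M-one , F-two) invariant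
           c₁ c₂ (c₁-injective , _ , C₁∩C₂≡∅ , _ , F⇔cycles)
           (σ , σ-stabilises , u* , u*∈C₁ , orbit-injective , orbit-covers) =
  GeneralisedPetersen.generalised-petersen n 3≤n X connected M F
    M-sym F-sym M⊆X F⊆X X⊆M⊎F M-one F-two invariant
    c₁ c₂ c₁-injective C₁∩C₂≡∅ F⇔cycles
    σ (Equivalence.to ∘ σ-stabilises) u* u*∈C₁ orbit-injective orbit-covers
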